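{- For $n\ge1$ and $0\le j\le\lfloor n/2\rfloor$, let $b(n,j)$ be the number of $\omega\in\mathcal{B}_n$ with exactly $j$ descents at odd positions and no descents at even positions, and let $g(n,i)=|\{u\in\mathfrak{S}_n:\mathrm{lpk}(u)=i\}|$. Then $$b(n,j)=\sum_{i=0}^{j}\binom{\lfloor n/2\rfloor-i}{j-i}\,g(n,i)\,2^i.$$
   Context: $\mathcal{B}_n$ is the set of signed permutations of $\{\pm1,\dots,\pm n\}$ ($\sigma(-i)=-\sigma(i)$), each identified with the word $\sigma(0)\sigma(1)\cdots\sigma(n)$ with $\sigma(0)=0$; a position $i\in\{0,\dots,n-1\}$ is a descent if $\sigma(i)>\sigma(i+1)$, and even positions include $0$. For $u\in\mathfrak{S}_n$, $\mathrm{lpk}(u)=|\{1\le i<n: u(i-1)<u(i)>u(i+1)\}|$ with $u(0)=0$, $u(n+1)=n+1$. -}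

module Defs where

open import Data.Nat using (ℕ; zero; suc; _+_; _*_; _∸_; _^_; _/_)
open import Data.Nat.Combinatorics using (_C_)
open import Data.Integer as ℤ using (ℤ; +_; -_; ∣_∣)
open import Data.Bool using (Bool; true; false; _∧_; not; if_then_else_)
open import Data.List using (List; []; _∷_; map; concatMap; length; filter; upTo)
open import Data.Bool.ListAction using (any)
open import Relation.Nullary.Decidable using (⌊_⌋)
open import Relation.Binary.PropositionalEquality using (_≡_)

words : {A : Set} → List A → ℕ → List (List A)
words alph zero = [] ∷ []
words alph (suc n) = concatMap (λ a → map (a ∷_) (words alph n)) alph

distinctℕ : List ℕ → Bool
distinctℕ [] = true
distinctℕ (x ∷ xs) = not (any (λ y → ⌊ x Data.Nat.≟ y ⌋) xs) ∧ distinctℕ xs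

oneTo : ℕ → List ℕ
oneTo n = map suc (upTo n)

perms : ℕ → List (List ℕ)
perms n = filter (λ w → distinctℕ w Data.Bool.≟ true) (words (oneTo n) n)

-- signed permutations of [n] as words ω(1)…ω(n) over {±1..±n}
-- whose absolute values are distinct (hence a permutation of 1..n)
signedAlph : ℕ → List ℤ
signedAlph n = map (λ k → + k) (oneTo n) Data.List.++ map (λ k → - (+ k)) (oneTo n)

signedPerms : ℕ → List (List ℤ)
signedPerms n = filter (λ w → distinctℕ (map ∣_∣ w) Data.Bool.≟ true) (words (signedAlph n) n)

-- descent test on the full word σ(0)σ(1)…σ(n) with σ(0)=0.
-- descOdd i w / descEven i w: number of descents at odd / even positions,
-- where the head of w sits at position i (positions i, i+1 compared).
isOdd : ℕ → Bool
isOdd zero = false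
isOdd (suc k) = not (isOdd k)

descAt : ℤ → ℤ → ℕ
descAt x y = if ⌊ y ℤ.<? x ⌋ then 1 else 0

descParity : Bool → ℕ → List ℤ → ℕ
descParity par i [] = 0
descParity par i (x ∷ []) = 0
descParity par i (x ∷ y ∷ ws) =
  (if ⌊ isOdd i Data.Bool.≟ par ⌋ then descAt x y else 0) + descParity par (suc i) (y ∷ ws)

oddDes : List ℤ → ℕ
oddDes w = descParity true 0 (+ 0 ∷ w)

evenDes : List ℤ → ℕ
evenDes w = descParity false 0 (+ 0 ∷ w)

b : ℕ → ℕ → ℕ
b n j = length (filter (λ w → ⌊ oddDes w Data.Nat.≟ j ⌋ ∧ ⌊ evenDes w Data.Nat.≟ 0 ⌋ Data.Bool.≟ true)
                       (signedPerms n))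

-- left peaks: on the word u(0)u(1)…u(n) with u(0)=0, count i with 1 ≤ i < n
-- and u(i-1) < u(i) > u(i+1).  (Triples centred at 1..n-1 only.)
peaks : List ℕ → ℕ
peaks (x ∷ y ∷ z ∷ ws) =
  (if ⌊ x Data.Nat.<? y ⌋ ∧ ⌊ z Data.Nat.<? y ⌋ then 1 else 0) + peaks (y ∷ z ∷ ws)
peaks _ = 0

lpk : List ℕ → ℕ
lpk u = peaks (0 ∷ u)

g : ℕ → ℕ → ℕ
g n i = length (filter (λ u → lpk u Data.Nat.≟ i) (perms n))

sumTo : ℕ → (ℕ → ℕ) → ℕ
sumTo zero f = f 0
sumTo (suc j) f = sumTo j f + f (suc j)

rhs : ℕ → ℕ → ℕ
rhs n j = sumTo j (λ i → ((n / 2 ∸ i) C (j ∸ i)) * g n i * 2 ^ i)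

-- Grouping signed permutations by their absolute values, b(n,j) is a sum over permutations u
-- of the number of signings of u with j odd descents and no even descent.  Since
-- ω(0) = 0 < ω(1), ω(2) < ω(3), ω(4) < ω(5), …, the word splits into blocks
-- ω(1) | ω(2)ω(3) | ω(4)ω(5) | …, and signings can be counted block by block with a transfer
-- matrix, t marking odd descents.  Each new block multiplies the generating polynomial by 2t if
-- u has a left peak at the first letter of the block or at the letter before it, and by 1 + t
-- otherwise, so u contributes (2t)^lpk(u) (1+t)^(⌊n/2⌋ - lpk(u)).  Its coefficient of t^j is
-- C(⌊n/2⌋ - lpk(u), j - lpk(u)) 2^lpk(u), and grouping the permutations by lpk gives the formula.

module Submission where

open import Defs
open import Data.Bool using (Bool; true; false; _∧_; _∨_; not; if_then_else_)
open import Data.Bool.Properties using (∧-zeroʳ; ∨-identityʳ)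
open import Data.Bool.ListAction using (any)
open import Data.Empty using (⊥-elim)
open import Data.Sum using (inj₁; inj₂)
open import Data.Integer as ℤ using (ℤ; -_; ∣_∣)
import Data.Integer.Properties as ℤₚ
open import Data.List using (List; []; _∷_; _++_; map; concatMap; length; filter; upTo)
open import Data.List.Relation.Unary.All using (All; []; _∷_; universal)
open import Data.List.Relation.Unary.All.Properties using (map⁺)
open import Data.List.Relation.Unary.Linked using (Linked; []; [-]; _∷_)
open import Data.Nat using (ℕ; zero; suc; _+_; _*_; _∸_; _^_; _/_; _≤_; _<_; z≤n; s≤s; ⌊_/2⌋)
open import Data.Nat.Combinatorics using (_C_; nCk+nC[k+1]≡[n+1]C[k+1])
open import Data.Nat.DivMod using (m/n≡1+[m∸n]/n)
open import Data.Nat.Properties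
open import Algebra.Properties.CommutativeSemigroup +-commutativeSemigroup using (interchange)
open import Data.Nat.Tactic.RingSolver using (solve-∀)
open import Function using (_∘_)
open import Relation.Binary.PropositionalEquality
open import Relation.Nullary.Decidable using (⌊_⌋; yes; no; ⌊⌋-map′; isYes≗does)
open import Relation.Unary using (Pred; Decidable)

-- Defined through if_then_else_ so that it agrees definitionally with descAt and peaks.
𝟙 : Bool → ℕ
𝟙 b = if b then 1 else 0

sumOver : {A : Set} → List A → (A → ℕ) → ℕ
sumOver []       f = 0
sumOver (x ∷ xs) f = f x + sumOver xs f

module _ {A : Set} where

  sumOver-cong : ∀ xs {f g : A → ℕ} → f ≗ g → sumOver xs f ≡ sumOver xs g
  sumOver-cong []       f≗g = refl
  sumOver-cong (x ∷ xs) f≗g = cong₂ _+_ (f≗g x) (sumOver-cong xs f≗g)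

  sumOver-cong-All : ∀ {ℓ} {P : Pred A ℓ} {xs} {f g : A → ℕ} →
                  All P xs → (∀ x → P x → f x ≡ g x) → sumOver xs f ≡ sumOver xs g
  sumOver-cong-All []         f≡g = refl
  sumOver-cong-All (px ∷ pxs) f≡g = cong₂ _+_ (f≡g _ px) (sumOver-cong-All pxs f≡g)

  sumOver-++ : ∀ xs ys (f : A → ℕ) → sumOver (xs ++ ys) f ≡ sumOver xs f + sumOver ys f
  sumOver-++ []       ys f = refl
  sumOver-++ (x ∷ xs) ys f = trans (cong (f x +_) (sumOver-++ xs ys f)) (sym (+-assoc (f x) _ _))

  sumOver-+ : ∀ xs (f g : A → ℕ) → sumOver xs f + sumOver xs g ≡ sumOver xs (λ x → f x + g x)
  sumOver-+ []       f g = refl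
  sumOver-+ (x ∷ xs) f g =
    trans (interchange (f x) (sumOver xs f) (g x) (sumOver xs g)) (cong (f x + g x +_) (sumOver-+ xs f g))

  *-sumOver : ∀ k xs (f : A → ℕ) → k * sumOver xs f ≡ sumOver xs (λ x → k * f x)
  *-sumOver k []       f = *-zeroʳ k
  *-sumOver k (x ∷ xs) f = trans (*-distribˡ-+ k (f x) _) (cong (k * f x +_) (*-sumOver k xs f))

  sumOver-* : ∀ xs (f : A → ℕ) k → sumOver xs f * k ≡ sumOver xs (λ x → f x * k)
  sumOver-* []       f k = refl
  sumOver-* (x ∷ xs) f k = trans (*-distribʳ-+ k (f x) _) (cong (f x * k +_) (sumOver-* xs f k))

  length-filter : ∀ {ℓ} {P : Pred A ℓ} (P? : Decidable P) xs →
                  length (filter P? xs) ≡ sumOver xs (λ x → 𝟙 ⌊ P? x ⌋)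
  length-filter P? []       = refl
  length-filter P? (x ∷ xs) with P? x
  ... | yes _ = cong suc (length-filter P? xs)
  ... | no  _ = length-filter P? xs

  sumOver-filter : ∀ {ℓ} {P : Pred A ℓ} (P? : Decidable P) xs f →
                   sumOver (filter P? xs) f ≡ sumOver xs (λ x → 𝟙 ⌊ P? x ⌋ * f x)
  sumOver-filter P? []       f = refl
  sumOver-filter P? (x ∷ xs) f with P? x
  ... | yes _ = cong₂ _+_ (sym (*-identityˡ (f x))) (sumOver-filter P? xs f)
  ... | no  _ = sumOver-filter P? xs f

module _ {A B : Set} where

  sumOver-map : ∀ (h : A → B) xs f → sumOver (map h xs) f ≡ sumOver xs (f ∘ h)
  sumOver-map h []       f = refl
  sumOver-map h (x ∷ xs) f = cong (f (h x) +_) (sumOver-map h xs f)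

  sumOver-concatMap : ∀ (h : A → List B) xs f → sumOver (concatMap h xs) f ≡ sumOver xs (λ x → sumOver (h x) f)
  sumOver-concatMap h []       f = refl
  sumOver-concatMap h (x ∷ xs) f =
    trans (sumOver-++ (h x) (concatMap h xs) f) (cong (sumOver (h x) f +_) (sumOver-concatMap h xs f))

length-filter-filter : ∀ {A : Set} {ℓ} {P Q : Pred A ℓ} (P? : Decidable P) (Q? : Decidable Q) xs →
  length (filter Q? (filter P? xs)) ≡ sumOver xs (λ x → 𝟙 ⌊ P? x ⌋ * 𝟙 ⌊ Q? x ⌋)
length-filter-filter P? Q? xs = trans (length-filter Q? (filter P? xs)) (sumOver-filter P? xs _)

module _ {A : Set} where

  sumOver-words-suc : ∀ (alph : List A) n f →
    sumOver (words alph (suc n)) f ≡ sumOver alph (λ a → sumOver (words alph n) (f ∘ (a ∷_)))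
  sumOver-words-suc alph n f =
    trans (sumOver-concatMap _ alph f) (sumOver-cong alph (λ a → sumOver-map (a ∷_) (words alph n) f))

  sumOver-words-cong : ∀ {ℓ} {P : Pred A ℓ} {alph} → All P alph → ∀ n {f g : List A → ℕ} →
    (∀ w → length w ≡ n → All P w → f w ≡ g w) → sumOver (words alph n) f ≡ sumOver (words alph n) g
  sumOver-words-cong P-alph zero    f≡g = cong (_+ 0) (f≡g [] refl [])
  sumOver-words-cong {alph = alph} P-alph (suc n) {f} {g} f≡g = begin
    sumOver (words alph (suc n)) f                              ≡⟨ sumOver-words-suc alph n f ⟩
    sumOver alph (λ a → sumOver (words alph n) (f ∘ (a ∷_)))
      ≡⟨ sumOver-cong-All P-alph (λ a Pa → sumOver-words-cong P-alph n
                                               (λ w ∣w∣ Pw → f≡g (a ∷ w) (cong suc ∣w∣) (Pa ∷ Pw))) ⟩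
    sumOver alph (λ a → sumOver (words alph n) (g ∘ (a ∷_)))  ≡⟨ sumOver-words-suc alph n g ⟨
    sumOver (words alph (suc n)) g                              ∎
    where open ≡-Reasoning

sumTo-cong : ∀ j {f g : ℕ → ℕ} → f ≗ g → sumTo j f ≡ sumTo j g
sumTo-cong zero    f≗g = f≗g 0
sumTo-cong (suc j) f≗g = cong₂ _+_ (sumTo-cong j f≗g) (f≗g (suc j))

*-sumTo : ∀ k j f → k * sumTo j f ≡ sumTo j (λ i → k * f i)
*-sumTo k zero    f = refl
*-sumTo k (suc j) f = trans (*-distribˡ-+ k (sumTo j f) _) (cong (_+ k * f (suc j)) (*-sumTo k j f))

sumTo-sumOver : ∀ {A : Set} j (xs : List A) (h : ℕ → A → ℕ) →
                sumTo j (λ i → sumOver xs (h i)) ≡ sumOver xs (λ x → sumTo j (λ i → h i x))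
sumTo-sumOver zero    xs h = refl
sumTo-sumOver (suc j) xs h = trans (cong (_+ sumOver xs (h (suc j))) (sumTo-sumOver j xs h)) (sumOver-+ xs _ _)

sumSignings : List ℕ → (List ℤ → ℕ) → ℕ
sumSignings []      f = f []
sumSignings (y ∷ u) f = sumSignings u (f ∘ (ℤ.+ y ∷_)) + sumSignings u (f ∘ (- ℤ.+ y ∷_))

sumSignings-cong : ∀ u {f g : List ℤ → ℕ} → f ≗ g → sumSignings u f ≡ sumSignings u g
sumSignings-cong []      f≗g = f≗g []
sumSignings-cong (y ∷ u) f≗g = cong₂ _+_ (sumSignings-cong u (f≗g ∘ _)) (sumSignings-cong u (f≗g ∘ _))

sumSignings-zero : ∀ u → sumSignings u (λ _ → 0) ≡ 0
sumSignings-zero []      = refl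
sumSignings-zero (y ∷ u) = cong₂ _+_ (sumSignings-zero u) (sumSignings-zero u)

sumSignings-abs : ∀ u (k : List ℕ → ℕ) f →
                  sumSignings u (λ w → k (map ∣_∣ w) * f w) ≡ k u * sumSignings u f
sumSignings-abs []      k f = refl
sumSignings-abs (y ∷ u) k f = begin
  sumSignings (y ∷ u) (λ w → k (map ∣_∣ w) * f w)
    ≡⟨ cong₂ _+_ (sumSignings-abs u (k ∘ (y ∷_)) _) (sumSignings-abs u (k ∘ (∣ - ℤ.+ y ∣ ∷_)) _) ⟩
  k (y ∷ u) * sumSignings u (f ∘ (ℤ.+ y ∷_)) + k (∣ - ℤ.+ y ∣ ∷ u) * sumSignings u (f ∘ (- ℤ.+ y ∷_))
    ≡⟨ cong (λ y′ → k (y ∷ u) * sumSignings u (f ∘ (ℤ.+ y ∷_)) + k (y′ ∷ u) * sumSignings u (f ∘ (- ℤ.+ y ∷_)))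
            (ℤₚ.∣-i∣≡∣i∣ (ℤ.+ y)) ⟩
  k (y ∷ u) * sumSignings u (f ∘ (ℤ.+ y ∷_)) + k (y ∷ u) * sumSignings u (f ∘ (- ℤ.+ y ∷_))
    ≡⟨ *-distribˡ-+ (k (y ∷ u)) _ _ ⟨
  k (y ∷ u) * sumSignings (y ∷ u) f ∎
  where open ≡-Reasoning

signedLetters : List ℕ → List ℤ
signedLetters L = map ℤ.+_ L ++ map (-_ ∘ ℤ.+_) L

sumOver-words-signedLetters : ∀ L n f →
  sumOver (words (signedLetters L) n) f ≡ sumOver (words L n) (λ u → sumSignings u f)
sumOver-words-signedLetters L zero    f = refl
sumOver-words-signedLetters L (suc n) f = begin
  sumOver (words (signedLetters L) (suc n)) f
    ≡⟨ sumOver-words-suc (signedLetters L) n f ⟩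
  sumOver (signedLetters L) (λ a → sumOver (words (signedLetters L) n) (f ∘ (a ∷_)))
    ≡⟨ sumOver-cong (signedLetters L) (λ a → sumOver-words-signedLetters L n (f ∘ (a ∷_))) ⟩
  sumOver (signedLetters L) F
    ≡⟨ sumOver-++ (map ℤ.+_ L) _ F ⟩
  sumOver (map ℤ.+_ L) F + sumOver (map (-_ ∘ ℤ.+_) L) F
    ≡⟨ cong₂ _+_ (sumOver-map ℤ.+_ L F) (sumOver-map (-_ ∘ ℤ.+_) L F) ⟩
  sumOver L (F ∘ ℤ.+_) + sumOver L (F ∘ -_ ∘ ℤ.+_)
    ≡⟨ sumOver-+ L _ _ ⟩
  sumOver L (λ k → F (ℤ.+ k) + F (- ℤ.+ k))
    ≡⟨ sumOver-cong L (λ k → sumOver-+ (words L n) _ _) ⟩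
  sumOver L (λ k → sumOver (words L n) (λ u → sumSignings (k ∷ u) f))
    ≡⟨ sumOver-words-suc L n (λ u → sumSignings u f) ⟨
  sumOver (words L (suc n)) (λ u → sumSignings u f) ∎
  where
  open ≡-Reasoning
  F : ℤ → ℕ
  F a = sumOver (words L n) (λ u → sumSignings u (f ∘ (a ∷_)))

⌊≟true⌋ : ∀ b → ⌊ b Data.Bool.≟ true ⌋ ≡ b
⌊≟true⌋ false = refl
⌊≟true⌋ true  = refl

⌊suc≟suc⌋ : ∀ m n → ⌊ suc m ≟ suc n ⌋ ≡ ⌊ m ≟ n ⌋
⌊suc≟suc⌋ m n = trans (isYes≗does (suc m ≟ suc n)) (sym (isYes≗does (m ≟ n)))

⌊≟⌋-≢ : ∀ {m n} → m ≢ n → ⌊ m ≟ n ⌋ ≡ false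
⌊≟⌋-≢ {m} {n} m≢n with m ≟ n
... | yes m≡n = ⊥-elim (m≢n m≡n)
... | no  _   = refl

⌊suc<?suc⌋ : ∀ m n → ⌊ m <? n ⌋ ≡ ⌊ suc m <? suc n ⌋
⌊suc<?suc⌋ m n = trans (isYes≗does (m <? n)) (sym (isYes≗does (suc m <? suc n)))

⌊+<?+⌋ : ∀ m n → ⌊ ℤ.+ m ℤ.<? ℤ.+ n ⌋ ≡ ⌊ m <? n ⌋
⌊+<?+⌋ m n = ⌊⌋-map′ ℤ.+<+ ℤₚ.drop‿+<+ (m <? n)

⌊-<?-⌋ : ∀ m n → ⌊ - ℤ.+ suc m ℤ.<? - ℤ.+ suc n ⌋ ≡ ⌊ suc n <? suc m ⌋
⌊-<?-⌋ m n = trans (⌊⌋-map′ ℤ.-<- ℤₚ.drop‿-<- (n <? m)) (⌊suc<?suc⌋ n m)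

⌊<?⌋-flip : ∀ {m n} → m ≢ n → ⌊ n <? m ⌋ ≡ not ⌊ m <? n ⌋
⌊<?⌋-flip {m} {n} m≢n with m <? n | n <? m
... | yes m<n | yes n<m = ⊥-elim (<-asym m<n n<m)
... | yes _   | no _    = refl
... | no _    | yes _   = refl
... | no m≮n  | no n≮m  = ⊥-elim (m≢n (≤-antisym (≮⇒≥ n≮m) (≮⇒≥ m≮n)))

-- Coefficient sequences of polynomials in t; shift multiplies by t.
Seq : Set
Seq = ℕ → ℕ

shift : Seq → Seq
shift f zero    = 0
shift f (suc j) = f j

shift-cong : ∀ {f g} → f ≗ g → shift f ≗ shift g
shift-cong f≗g zero    = refl
shift-cong f≗g (suc j) = f≗g j

twice : Seq → Seq
twice f j = f j + f j

shift-twice : ∀ f → shift (twice f) ≗ twice (shift f)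
shift-twice f zero    = refl
shift-twice f (suc j) = refl

one : Seq
one zero    = 1
one (suc j) = 0

onlyIf : Bool → Seq → Seq
onlyIf true  f j = f j
onlyIf false f j = 0

onlyIf-cong : ∀ b {f g} → f ≗ g → onlyIf b f ≗ onlyIf b g
onlyIf-cong true  f≗g j = f≗g j
onlyIf-cong false f≗g j = refl

shift-onlyIf : ∀ b f → shift (onlyIf b f) ≗ onlyIf b (shift f)
shift-onlyIf true  f j       = refl
shift-onlyIf false f zero    = refl
shift-onlyIf false f (suc j) = refl

signsOf : Bool → Seq → Seq
signsOf true  f j = f j
signsOf false f j = twice f j

signsOf-cong : ∀ forced {f g} → f ≗ g → signsOf forced f ≗ signsOf forced g
signsOf-cong true  f≗g j = f≗g j
signsOf-cong false f≗g j = cong₂ _+_ (f≗g j) (f≗g j)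

grow : Bool → Seq → Seq
grow true  f j = twice (shift f) j
grow false f j = f j + shift f j

twice-shift+twice : ∀ f j → twice (shift f) j + twice f j ≡ twice (grow false f) j
twice-shift+twice f j =
  trans (+-comm (twice (shift f) j) (twice f j)) (sym (interchange (f j) (shift f j) (f j) (shift f j)))

-- One comparison of adjacent letters: an ascent contributes 1, a descent t at an odd position
-- and 0 at an even one.
transfer : Bool → Bool → Seq → Seq
transfer odd?  false f j = f j
transfer true  true  f j = shift f j
transfer false true  f j = 0

transfer-cong : ∀ odd? descent? {f g} → f ≗ g → transfer odd? descent? f ≗ transfer odd? descent? g
transfer-cong odd?  false f≗g j       = f≗g j
transfer-cong true  true  f≗g zero    = refl
transfer-cong true  true  f≗g (suc j) = f≗g j
transfer-cong false true  f≗g j       = refl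

sumSignings-transfer : ∀ u odd? descent? (F : List ℤ → Seq) j →
  sumSignings u (λ w → transfer odd? descent? (F w) j)
    ≡ transfer odd? descent? (λ i → sumSignings u (λ w → F w i)) j
sumSignings-transfer u odd?  false F j       = refl
sumSignings-transfer u true  true  F zero    = sumSignings-zero u
sumSignings-transfer u true  true  F (suc j) = refl
sumSignings-transfer u false true  F j       = sumSignings-zero u

signings : Bool → ℤ → List ℕ → Seq
signings odd? x []      j = one j
signings odd? x (y ∷ u) j =
  transfer odd? ⌊ ℤ.+ y ℤ.<? x ⌋ (signings (not odd?) (ℤ.+ y) u) j +
  transfer odd? ⌊ - ℤ.+ y ℤ.<? x ⌋ (signings (not odd?) (- ℤ.+ y) u) j

admissible : ℕ → ℤ → List ℤ → Seq
admissible i x w j = 𝟙 (⌊ descParity true i (x ∷ w) ≟ j ⌋ ∧ ⌊ descParity false i (x ∷ w) ≟ 0 ⌋)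

admissible-cons : ∀ i x z w → admissible i x (z ∷ w) ≗ transfer (isOdd i) ⌊ z ℤ.<? x ⌋ (admissible (suc i) z w)
admissible-cons i x z w j with isOdd i | ⌊ z ℤ.<? x ⌋ | j
... | true  | false | _     = refl
... | true  | true  | zero  = refl
... | true  | true  | suc k = cong (λ b → 𝟙 (b ∧ _)) (⌊suc≟suc⌋ (descParity true (suc i) (z ∷ w)) k)
... | false | false | _     = refl
... | false | true  | _     = cong 𝟙 (∧-zeroʳ _)

sumSignings-admissible : ∀ u i x j → sumSignings u (λ w → admissible i x w j) ≡ signings (isOdd i) x u j
sumSignings-admissible []      i x zero    = refl
sumSignings-admissible []      i x (suc j) = refl
sumSignings-admissible (y ∷ u) i x j = cong₂ _+_ (extend (ℤ.+ y)) (extend (- ℤ.+ y))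
  where
  open ≡-Reasoning
  extend : ∀ z → sumSignings u (λ w → admissible i x (z ∷ w) j)
               ≡ transfer (isOdd i) ⌊ z ℤ.<? x ⌋ (signings (isOdd (suc i)) z u) j
  extend z = begin
    sumSignings u (λ w → admissible i x (z ∷ w) j)
      ≡⟨ sumSignings-cong u (λ w → admissible-cons i x z w j) ⟩
    sumSignings u (λ w → transfer (isOdd i) ⌊ z ℤ.<? x ⌋ (admissible (suc i) z w) j)
      ≡⟨ sumSignings-transfer u (isOdd i) ⌊ z ℤ.<? x ⌋ (admissible (suc i) z) j ⟩
    transfer (isOdd i) ⌊ z ℤ.<? x ⌋ (λ k → sumSignings u (λ w → admissible (suc i) z w k)) j
      ≡⟨ transfer-cong (isOdd i) ⌊ z ℤ.<? x ⌋ (sumSignings-admissible u (suc i) z) j ⟩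
    transfer (isOdd i) ⌊ z ℤ.<? x ⌋ (signings (isOdd (suc i)) z u) j ∎

b≡sumOver-signings : ∀ n j →
  b n j ≡ sumOver (words (oneTo n) n) (λ u → 𝟙 (distinctℕ u) * signings false (ℤ.+ 0) u j)
b≡sumOver-signings n j = begin
  b n j
    ≡⟨ length-filter-filter _ _ W± ⟩
  sumOver W± (λ w → 𝟙 ⌊ distinctℕ (map ∣_∣ w) Data.Bool.≟ true ⌋ * 𝟙 ⌊ admissible? w Data.Bool.≟ true ⌋)
    ≡⟨ sumOver-cong W± (λ w → cong₂ (λ p q → 𝟙 p * 𝟙 q)
                                      (⌊≟true⌋ (distinctℕ (map ∣_∣ w))) (⌊≟true⌋ (admissible? w))) ⟩
  sumOver W± (λ w → 𝟙 (distinctℕ (map ∣_∣ w)) * admissible 0 (ℤ.+ 0) w j)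
    ≡⟨ sumOver-words-signedLetters (oneTo n) n _ ⟩
  sumOver W (λ u → sumSignings u (λ w → 𝟙 (distinctℕ (map ∣_∣ w)) * admissible 0 (ℤ.+ 0) w j))
    ≡⟨ sumOver-cong W (λ u → sumSignings-abs u (𝟙 ∘ distinctℕ) _) ⟩
  sumOver W (λ u → 𝟙 (distinctℕ u) * sumSignings u (λ w → admissible 0 (ℤ.+ 0) w j))
    ≡⟨ sumOver-cong W (λ u → cong (𝟙 (distinctℕ u) *_) (sumSignings-admissible u 0 (ℤ.+ 0) j)) ⟩
  sumOver W (λ u → 𝟙 (distinctℕ u) * signings false (ℤ.+ 0) u j) ∎
  where
  open ≡-Reasoning
  W  = words (oneTo n) n
  W± = words (signedLetters (oneTo n)) n
  admissible? : List ℤ → Bool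
  admissible? w = ⌊ oddDes w ≟ j ⌋ ∧ ⌊ evenDes w ≟ 0 ⌋

-- The coefficient of t^j in (2t)^L (1+t)^A.
peakGF : ℕ → ℕ → Seq
peakGF A zero    j = A C j
peakGF A (suc L) j = twice (shift (peakGF A L)) j

peakGF-pascal : ∀ A L → peakGF (suc A) L ≗ grow false (peakGF A L)
peakGF-pascal A zero    zero    = refl
peakGF-pascal A zero    (suc j) = trans (sym (nCk+nC[k+1]≡[n+1]C[k+1] A j)) (+-comm (A C j) (A C suc j))
peakGF-pascal A (suc L) zero    = refl
peakGF-pascal A (suc L) (suc j) =
  trans (cong₂ _+_ (peakGF-pascal A L j) (peakGF-pascal A L j))
        (interchange (peakGF A L j) (shift (peakGF A L) j) (peakGF A L j) (shift (peakGF A L) j))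

peakGF-grow : ∀ peak? A L → grow peak? (peakGF A L) ≗ peakGF (𝟙 (not peak?) + A) (𝟙 peak? + L)
peakGF-grow true  A L j = refl
peakGF-grow false A L j = sym (peakGF-pascal A L j)

one≗peakGF-0-0 : one ≗ peakGF 0 0
one≗peakGF-0-0 zero    = refl
one≗peakGF-0-0 (suc j) = refl

peakGF-≤ : ∀ A L j → L ≤ j → peakGF A L j ≡ (A C (j ∸ L)) * 2 ^ L
peakGF-≤ A zero    j       _         = sym (*-identityʳ (A C j))
peakGF-≤ A (suc L) (suc j) (s≤s L≤j) =
  trans (cong₂ _+_ (peakGF-≤ A L j L≤j) (peakGF-≤ A L j L≤j)) (double (A C (j ∸ L)) (2 ^ L))
  where
  double : ∀ x y → x * y + x * y ≡ x * (2 * y)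
  double = solve-∀

peakGF-< : ∀ A L j → j < L → peakGF A L j ≡ 0
peakGF-< A (suc L) zero    _         = refl
peakGF-< A (suc L) (suc j) (s≤s j<L) = cong₂ _+_ (peakGF-< A L j j<L) (peakGF-< A L j j<L)

-- For consecutive letters p c a b of u: a left peak at c or at a.
newPeak : Bool → Bool → Bool → Bool
newPeak p<c a<c a<b = p<c ∧ a<c ∨ not a<c ∧ not a<b

peaks-cons : ∀ p c a b r → a ≢ c → a ≢ b →
  peaks (p ∷ c ∷ a ∷ b ∷ r) ≡ 𝟙 (newPeak ⌊ p <? c ⌋ ⌊ a <? c ⌋ ⌊ a <? b ⌋) + peaks (a ∷ b ∷ r)
peaks-cons p c a b r a≢c a≢b =
  trans (cong₂ (λ c<a b<a → 𝟙 (⌊ p <? c ⌋ ∧ ⌊ a <? c ⌋) + (𝟙 (c<a ∧ b<a) + peaks (a ∷ b ∷ r)))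
               (⌊<?⌋-flip a≢c) (⌊<?⌋-flip a≢b))
        (merge ⌊ p <? c ⌋ ⌊ a <? c ⌋)
  where
  merge : ∀ p<c a<c → 𝟙 (p<c ∧ a<c) + (𝟙 (not a<c ∧ not ⌊ a <? b ⌋) + peaks (a ∷ b ∷ r))
                    ≡ 𝟙 (newPeak p<c a<c ⌊ a <? b ⌋) + peaks (a ∷ b ∷ r)
  merge true  true  = refl
  merge false true  = refl
  merge true  false = refl
  merge false false = refl

newPeak-last : ∀ p<c a<c → newPeak p<c a<c true ≡ p<c ∧ a<c
newPeak-last p<c true  = ∨-identityʳ _
newPeak-last p<c false = ∨-identityʳ _

𝟙≤1 : ∀ b → 𝟙 b ≤ 1
𝟙≤1 true  = ≤-refl
𝟙≤1 false = z≤n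

peaks≤⌊/2⌋ : ∀ p c r → Linked _≢_ (c ∷ r) → peaks (p ∷ c ∷ r) ≤ ⌊ suc (length r) /2⌋
peaks≤⌊/2⌋ p c []          _                    = z≤n
peaks≤⌊/2⌋ p c (a ∷ [])    _                    = ≤-trans (≤-reflexive (+-identityʳ _)) (𝟙≤1 _)
peaks≤⌊/2⌋ p c (a ∷ b ∷ r) (c≢a ∷ a≢b ∷ linked) = begin
  peaks (p ∷ c ∷ a ∷ b ∷ r)
    ≡⟨ peaks-cons p c a b r (c≢a ∘ sym) a≢b ⟩
  𝟙 (newPeak ⌊ p <? c ⌋ ⌊ a <? c ⌋ ⌊ a <? b ⌋) + peaks (a ∷ b ∷ r)
    ≤⟨ +-mono-≤ (𝟙≤1 _) (peaks≤⌊/2⌋ a b r linked) ⟩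
  suc ⌊ suc (length r) /2⌋ ∎
  where open ≤-Reasoning

suc∸𝟙+ : ∀ peak? {L H} → L ≤ H → suc H ∸ (𝟙 peak? + L) ≡ 𝟙 (not peak?) + (H ∸ L)
suc∸𝟙+ true  L≤H = refl
suc∸𝟙+ false L≤H = +-∸-assoc 1 L≤H

-- c is the last letter of a block.  Its sign is forced to be + exactly when its predecessor in u
-- is smaller, because the ascent inside the block then rules out -c.
fromRightEnd : Bool → ℕ → List ℕ → Seq
fromRightEnd true  c r j = signings true (ℤ.+ c) r j
fromRightEnd false c r j = signings true (ℤ.+ c) r j + signings true (- ℤ.+ c) r j

-- The polynomial counted from the end c of a block, given those counted from the first letter
-- of the next block with sign + (e⁺) and - (e⁻).
extendLeft : Bool → Bool → Seq → Seq → Seq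
extendLeft true  a<c e⁺ e⁻ j = transfer true a<c e⁺ j + shift e⁻ j
extendLeft false a<c e⁺ e⁻ j = extendLeft true a<c e⁺ e⁻ j + (e⁺ j + transfer true (not a<c) e⁻ j)

extendLeft-cong : ∀ forced a<c {e⁺ f⁺ e⁻ f⁻} → e⁺ ≗ f⁺ → e⁻ ≗ f⁻ →
                  extendLeft forced a<c e⁺ e⁻ ≗ extendLeft forced a<c f⁺ f⁻
extendLeft-cong true  a<c h⁺ h⁻ j = cong₂ _+_ (transfer-cong true a<c h⁺ j) (shift-cong h⁻ j)
extendLeft-cong false a<c h⁺ h⁻ j =
  cong₂ _+_ (extendLeft-cong true a<c h⁺ h⁻ j) (cong₂ _+_ (h⁺ j) (transfer-cong true (not a<c) h⁻ j))

extendLeft-grow : ∀ forced a<c a<b f →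
  extendLeft forced a<c (onlyIf a<b (signsOf a<b f)) (signsOf a<b f) ≗ signsOf forced (grow (newPeak forced a<c a<b) f)
extendLeft-grow true  true  true  f j = refl
extendLeft-grow true  true  false f j = cong₂ _+_ (shift-onlyIf false (twice f) j) (shift-twice f j)
extendLeft-grow true  false true  f j = refl
extendLeft-grow true  false false f j = shift-twice f j
extendLeft-grow false true  true  f j = twice-shift+twice f j
extendLeft-grow false true  false f j =
  trans (cong (_+ twice f j) (cong₂ _+_ (shift-onlyIf false (twice f) j) (shift-twice f j))) (twice-shift+twice f j)
extendLeft-grow false false true  f j = refl
extendLeft-grow false false false f j = cong₂ _+_ (shift-twice f j) (shift-twice f j)

fromRightEnd-cons : ∀ forced c a rest → suc a ≢ suc c →
  fromRightEnd forced (suc c) (suc a ∷ rest)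
    ≗ extendLeft forced ⌊ suc a <? suc c ⌋ (signings false (ℤ.+ suc a) rest) (signings false (- ℤ.+ suc a) rest)
fromRightEnd-cons true  c a rest a≢c j =
  cong (λ d → transfer true d (signings false (ℤ.+ suc a) rest) j + _) (⌊+<?+⌋ (suc a) (suc c))
fromRightEnd-cons false c a rest a≢c j =
  cong₂ _+_ (fromRightEnd-cons true c a rest a≢c j)
            (cong (λ d → _ + transfer true d (signings false (- ℤ.+ suc a) rest) j)
                  (trans (⌊-<?-⌋ a c) (⌊<?⌋-flip a≢c)))

-- No descent at an even position: after +a the next letter must be +b with a < b, while after -a
-- it is +b, or either sign of b when b < a.
signings-block⁺ : ∀ a b r → suc a ≢ suc b →
  signings false (ℤ.+ suc a) (suc b ∷ r)
    ≗ onlyIf ⌊ suc a <? suc b ⌋ (fromRightEnd ⌊ suc a <? suc b ⌋ (suc b) r)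
signings-block⁺ a b r a≢b j =
  trans (cong (λ d → transfer false d (signings true (ℤ.+ suc b) r) j + 0)
              (trans (⌊+<?+⌋ (suc b) (suc a)) (⌊<?⌋-flip a≢b)))
        (close ⌊ suc a <? suc b ⌋)
  where
  close : ∀ a<b → transfer false (not a<b) (signings true (ℤ.+ suc b) r) j + 0
                ≡ onlyIf a<b (fromRightEnd a<b (suc b) r) j
  close true  = +-identityʳ _
  close false = refl

signings-block⁻ : ∀ a b r →
  signings false (- ℤ.+ suc a) (suc b ∷ r) ≗ fromRightEnd ⌊ suc a <? suc b ⌋ (suc b) r
signings-block⁻ a b r j =
  trans (cong (λ d → _ + transfer false d (signings true (- ℤ.+ suc b) r) j) (⌊-<?-⌋ b a))
        (close ⌊ suc a <? suc b ⌋)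
  where
  close : ∀ a<b → signings true (ℤ.+ suc b) r j + transfer false a<b (signings true (- ℤ.+ suc b) r) j
                ≡ fromRightEnd a<b (suc b) r j
  close true  = +-identityʳ _
  close false = refl

fromRightEnd-extend : ∀ forced c a rest a<b f → suc a ≢ suc c →
  signings false (ℤ.+ suc a) rest ≗ onlyIf a<b (signsOf a<b f) →
  signings false (- ℤ.+ suc a) rest ≗ signsOf a<b f →
  fromRightEnd forced (suc c) (suc a ∷ rest) ≗ signsOf forced (grow (newPeak forced ⌊ suc a <? suc c ⌋ a<b) f)
fromRightEnd-extend forced c a rest a<b f a≢c h⁺ h⁻ j = begin
  fromRightEnd forced (suc c) (suc a ∷ rest) j
    ≡⟨ fromRightEnd-cons forced c a rest a≢c j ⟩
  extendLeft forced a<c (signings false (ℤ.+ suc a) rest) (signings false (- ℤ.+ suc a) rest) j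
    ≡⟨ extendLeft-cong forced a<c h⁺ h⁻ j ⟩
  extendLeft forced a<c (onlyIf a<b (signsOf a<b f)) (signsOf a<b f) j
    ≡⟨ extendLeft-grow forced a<c a<b f j ⟩
  signsOf forced (grow (newPeak forced a<c a<b) f) j ∎
  where
  open ≡-Reasoning
  a<c = ⌊ suc a <? suc c ⌋

fromRightEnd-[] : ∀ forced c → fromRightEnd forced c [] ≗ signsOf forced (peakGF 0 0)
fromRightEnd-[] true  c = signsOf-cong true one≗peakGF-0-0
fromRightEnd-[] false c = signsOf-cong false one≗peakGF-0-0

fromRightEnd-peakGF : ∀ p c r → All (0 <_) (c ∷ r) → Linked _≢_ (c ∷ r) →
  fromRightEnd ⌊ p <? c ⌋ c r
    ≗ signsOf ⌊ p <? c ⌋ (peakGF (⌊ suc (length r) /2⌋ ∸ peaks (p ∷ c ∷ r)) (peaks (p ∷ c ∷ r)))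
fromRightEnd-peakGF p zero    r            (() ∷ _)     _
fromRightEnd-peakGF p (suc c) []           _            _ = fromRightEnd-[] ⌊ p <? suc c ⌋ (suc c)
fromRightEnd-peakGF p (suc c) (zero ∷ r)   (_ ∷ () ∷ _) _
fromRightEnd-peakGF p (suc c) (suc a ∷ []) _            (c≢a ∷ [-]) j = begin
  fromRightEnd p<c (suc c) (suc a ∷ []) j
    ≡⟨ fromRightEnd-extend p<c c a [] true (peakGF 0 0) (c≢a ∘ sym) one≗peakGF-0-0 one≗peakGF-0-0 j ⟩
  signsOf p<c (grow (newPeak p<c a<c true) (peakGF 0 0)) j
    ≡⟨ signsOf-cong p<c (peakGF-grow (newPeak p<c a<c true) 0 0) j ⟩
  signsOf p<c (peakGF (𝟙 (not (newPeak p<c a<c true)) + 0) (𝟙 (newPeak p<c a<c true) + 0)) j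
    ≡⟨ cong (λ q → signsOf p<c (peakGF (𝟙 (not q) + 0) (𝟙 q + 0)) j) (newPeak-last p<c a<c) ⟩
  signsOf p<c (peakGF (𝟙 (not (p<c ∧ a<c)) + 0) (𝟙 (p<c ∧ a<c) + 0)) j
    ≡⟨ cong (λ A → signsOf p<c (peakGF A (𝟙 (p<c ∧ a<c) + 0)) j) (suc∸𝟙+ (p<c ∧ a<c) z≤n) ⟨
  signsOf p<c (peakGF (1 ∸ (𝟙 (p<c ∧ a<c) + 0)) (𝟙 (p<c ∧ a<c) + 0)) j ∎
  where
  open ≡-Reasoning
  p<c = ⌊ p <? suc c ⌋
  a<c = ⌊ suc a <? suc c ⌋
fromRightEnd-peakGF p (suc c) (suc a ∷ zero ∷ r)  (_ ∷ _ ∷ () ∷ _) _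
fromRightEnd-peakGF p (suc c) (suc a ∷ suc b ∷ r) (_ ∷ _ ∷ pos)    (c≢a ∷ a≢b ∷ linked) j = begin
  fromRightEnd p<c (suc c) (suc a ∷ suc b ∷ r) j
    ≡⟨ fromRightEnd-extend p<c c a (suc b ∷ r) a<b f (c≢a ∘ sym) h⁺ h⁻ j ⟩
  signsOf p<c (grow q f) j
    ≡⟨ signsOf-cong p<c (peakGF-grow q (H ∸ L) L) j ⟩
  signsOf p<c (peakGF (𝟙 (not q) + (H ∸ L)) (𝟙 q + L)) j
    ≡⟨ cong (λ A → signsOf p<c (peakGF A (𝟙 q + L)) j)
            (suc∸𝟙+ q (peaks≤⌊/2⌋ (suc a) (suc b) r linked)) ⟨
  signsOf p<c (peakGF (suc H ∸ (𝟙 q + L)) (𝟙 q + L)) j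
    ≡⟨ cong (λ L′ → signsOf p<c (peakGF (suc H ∸ L′) L′) j)
            (peaks-cons p (suc c) (suc a) (suc b) r (c≢a ∘ sym) a≢b) ⟨
  signsOf p<c (peakGF (suc H ∸ L′) L′) j ∎
  where
  open ≡-Reasoning
  p<c = ⌊ p <? suc c ⌋
  a<c = ⌊ suc a <? suc c ⌋
  a<b = ⌊ suc a <? suc b ⌋
  q = newPeak p<c a<c a<b
  H = ⌊ suc (length r) /2⌋
  L = peaks (suc a ∷ suc b ∷ r)
  L′ = peaks (p ∷ suc c ∷ suc a ∷ suc b ∷ r)
  f = peakGF (H ∸ L) L
  ih : fromRightEnd a<b (suc b) r ≗ signsOf a<b f
  ih = fromRightEnd-peakGF (suc a) (suc b) r pos linked
  h⁺ : signings false (ℤ.+ suc a) (suc b ∷ r) ≗ onlyIf a<b (signsOf a<b f)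
  h⁺ i = trans (signings-block⁺ a b r a≢b i) (onlyIf-cong a<b ih i)
  h⁻ : signings false (- ℤ.+ suc a) (suc b ∷ r) ≗ signsOf a<b f
  h⁻ i = trans (signings-block⁻ a b r i) (ih i)

signings-peakGF : ∀ c r → All (0 <_) (c ∷ r) → Linked _≢_ (c ∷ r) →
  signings false (ℤ.+ 0) (c ∷ r) ≗ peakGF (⌊ length (c ∷ r) /2⌋ ∸ lpk (c ∷ r)) (lpk (c ∷ r))
signings-peakGF zero    r (() ∷ _) _
signings-peakGF (suc c) r pos linked j = trans (+-identityʳ _) (fromRightEnd-peakGF 0 (suc c) r pos linked j)

distinct-head : ∀ x y r → distinctℕ (x ∷ y ∷ r) ≡ true → x ≢ y
distinct-head x y r e x≡y with x ≟ y
... | yes _   with () ← e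
... | no x≢y = x≢y x≡y

distinct-tail : ∀ x r → distinctℕ (x ∷ r) ≡ true → distinctℕ r ≡ true
distinct-tail x r e with not (any (λ y → ⌊ x ≟ y ⌋) r)
... | true = e

distinct⇒linked : ∀ u → distinctℕ u ≡ true → Linked _≢_ u
distinct⇒linked []          _ = []
distinct⇒linked (x ∷ [])    _ = [-]
distinct⇒linked (x ∷ y ∷ r) e =
  distinct-head x y r e ∷ distinct⇒linked (y ∷ r) (distinct-tail x (y ∷ r) e)

n/2≡⌊n/2⌋ : ∀ n → n / 2 ≡ ⌊ n /2⌋
n/2≡⌊n/2⌋ zero          = refl
n/2≡⌊n/2⌋ (suc zero)    = refl
n/2≡⌊n/2⌋ (suc (suc n)) =
  trans (m/n≡1+[m∸n]/n {suc (suc n)} {2} (s≤s (s≤s z≤n))) (cong suc (n/2≡⌊n/2⌋ n))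

distinct-signings≡peakGF : ∀ n u j → 1 ≤ n → length u ≡ n → All (0 <_) u →
  𝟙 (distinctℕ u) * signings false (ℤ.+ 0) u j ≡ 𝟙 (distinctℕ u) * peakGF (n / 2 ∸ lpk u) (lpk u) j
distinct-signings≡peakGF _ []      j () refl _
distinct-signings≡peakGF _ (c ∷ r) j _  refl pos with distinctℕ (c ∷ r) in distinct
... | false = refl
... | true  = cong (1 *_) (begin
  signings false (ℤ.+ 0) (c ∷ r) j
    ≡⟨ signings-peakGF c r pos (distinct⇒linked (c ∷ r) distinct) j ⟩
  peakGF (⌊ suc (length r) /2⌋ ∸ lpk (c ∷ r)) (lpk (c ∷ r)) j
    ≡⟨ cong (λ h → peakGF (h ∸ lpk (c ∷ r)) (lpk (c ∷ r)) j) (n/2≡⌊n/2⌋ (suc (length r))) ⟨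
  peakGF (suc (length r) / 2 ∸ lpk (c ∷ r)) (lpk (c ∷ r)) j ∎)
  where open ≡-Reasoning

sumTo-indicator-< : ∀ L j (h : ℕ → ℕ) → j < L → sumTo j (λ i → 𝟙 ⌊ L ≟ i ⌋ * h i) ≡ 0
sumTo-indicator-< (suc L) zero    h _   = refl
sumTo-indicator-< L       (suc j) h j<L =
  cong₂ _+_ (sumTo-indicator-< L j h (<-trans (n<1+n j) j<L))
            (cong (λ e → 𝟙 e * h (suc j)) (⌊≟⌋-≢ (>⇒≢ j<L)))

sumTo-indicator-≤ : ∀ L j (h : ℕ → ℕ) → L ≤ j → sumTo j (λ i → 𝟙 ⌊ L ≟ i ⌋ * h i) ≡ h L
sumTo-indicator-≤ zero zero    h _ = +-identityʳ (h 0)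
sumTo-indicator-≤ L    (suc j) h L≤1+j with m≤n⇒m<n∨m≡n L≤1+j
... | inj₁ L<1+j = trans (cong₂ _+_ (sumTo-indicator-≤ L j h (≤-pred L<1+j))
                                    (cong (λ e → 𝟙 e * h (suc j)) (⌊≟⌋-≢ (<⇒≢ L<1+j))))
                         (+-identityʳ (h L))
... | inj₂ refl  = trans (cong₂ _+_ (sumTo-indicator-< (suc j) j h ≤-refl)
                                    (cong (λ e → 𝟙 e * h (suc j)) (cong ⌊_⌋ (≟-diag {suc j} refl))))
                         (+-identityʳ (h (suc j)))

sumTo-indicator≡peakGF : ∀ N L j →
  sumTo j (λ i → 𝟙 ⌊ L ≟ i ⌋ * (((N ∸ i) C (j ∸ i)) * 2 ^ i)) ≡ peakGF (N ∸ L) L j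
sumTo-indicator≡peakGF N L j with L ≤? j
... | yes L≤j = trans (sumTo-indicator-≤ L j _ L≤j) (sym (peakGF-≤ (N ∸ L) L j L≤j))
... | no  L≰j = trans (sumTo-indicator-< L j _ (≰⇒> L≰j)) (sym (peakGF-< (N ∸ L) L j (≰⇒> L≰j)))

g≡sumOver : ∀ n i → g n i ≡ sumOver (words (oneTo n) n) (λ u → 𝟙 (distinctℕ u) * 𝟙 ⌊ lpk u ≟ i ⌋)
g≡sumOver n i =
  trans (length-filter-filter _ _ (words (oneTo n) n))
        (sumOver-cong (words (oneTo n) n)
                      (λ u → cong (λ d → 𝟙 d * 𝟙 ⌊ lpk u ≟ i ⌋) (⌊≟true⌋ (distinctℕ u))))

rhs≡sumOver-peakGF : ∀ n j →
  rhs n j ≡ sumOver (words (oneTo n) n) (λ u → 𝟙 (distinctℕ u) * peakGF (n / 2 ∸ lpk u) (lpk u) j)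
rhs≡sumOver-peakGF n j = begin
  rhs n j
    ≡⟨ sumTo-cong j distribute ⟩
  sumTo j (λ i → sumOver W (λ u → 𝟙 (distinctℕ u) * (𝟙 ⌊ lpk u ≟ i ⌋ * (K i * 2 ^ i))))
    ≡⟨ sumTo-sumOver j W _ ⟩
  sumOver W (λ u → sumTo j (λ i → 𝟙 (distinctℕ u) * (𝟙 ⌊ lpk u ≟ i ⌋ * (K i * 2 ^ i))))
    ≡⟨ sumOver-cong W (λ u → *-sumTo (𝟙 (distinctℕ u)) j _) ⟨
  sumOver W (λ u → 𝟙 (distinctℕ u) * sumTo j (λ i → 𝟙 ⌊ lpk u ≟ i ⌋ * (K i * 2 ^ i)))
    ≡⟨ sumOver-cong W (λ u → cong (𝟙 (distinctℕ u) *_) (sumTo-indicator≡peakGF (n / 2) (lpk u) j)) ⟩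
  sumOver W (λ u → 𝟙 (distinctℕ u) * peakGF (n / 2 ∸ lpk u) (lpk u) j) ∎
  where
  open ≡-Reasoning
  W = words (oneTo n) n
  K : ℕ → ℕ
  K i = (n / 2 ∸ i) C (j ∸ i)
  rearrange : ∀ k d e p → k * (d * e) * p ≡ d * (e * (k * p))
  rearrange = solve-∀
  distribute : ∀ i →
    K i * g n i * 2 ^ i ≡ sumOver W (λ u → 𝟙 (distinctℕ u) * (𝟙 ⌊ lpk u ≟ i ⌋ * (K i * 2 ^ i)))
  distribute i = begin
    K i * g n i * 2 ^ i
      ≡⟨ cong (λ t → K i * t * 2 ^ i) (g≡sumOver n i) ⟩
    K i * sumOver W (λ u → 𝟙 (distinctℕ u) * 𝟙 ⌊ lpk u ≟ i ⌋) * 2 ^ i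
      ≡⟨ cong (_* 2 ^ i) (*-sumOver (K i) W _) ⟩
    sumOver W (λ u → K i * (𝟙 (distinctℕ u) * 𝟙 ⌊ lpk u ≟ i ⌋)) * 2 ^ i
      ≡⟨ sumOver-* W _ (2 ^ i) ⟩
    sumOver W (λ u → K i * (𝟙 (distinctℕ u) * 𝟙 ⌊ lpk u ≟ i ⌋) * 2 ^ i)
      ≡⟨ sumOver-cong W (λ u → rearrange (K i) (𝟙 (distinctℕ u)) (𝟙 ⌊ lpk u ≟ i ⌋) (2 ^ i)) ⟩
    sumOver W (λ u → 𝟙 (distinctℕ u) * (𝟙 ⌊ lpk u ≟ i ⌋ * (K i * 2 ^ i))) ∎

lemma2p12 : (n j : ℕ) → 1 ≤ n → j ≤ n / 2 → b n j ≡ rhs n j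
lemma2p12 n j 1≤n _ = begin
  b n j
    ≡⟨ b≡sumOver-signings n j ⟩
  sumOver W (λ u → 𝟙 (distinctℕ u) * signings false (ℤ.+ 0) u j)
    ≡⟨ sumOver-words-cong (map⁺ (universal (λ _ → s≤s z≤n) (upTo n))) n
                          (λ u → distinct-signings≡peakGF n u j 1≤n) ⟩
  sumOver W (λ u → 𝟙 (distinctℕ u) * peakGF (n / 2 ∸ lpk u) (lpk u) j)
    ≡⟨ rhs≡sumOver-peakGF n j ⟨
  rhs n j ∎
  where
  open ≡-Reasoning
  W = words (oneTo n) n
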